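{- A graph $G$ has a Sachs subgraph if and only if $\ker(G)=\emptyset$.
   Context: All graphs are finite and simple. A Sachs subgraph of a graph is a spanning subgraph each of whose connected components is either a single edge ($K_2$) or a cycle. For $S\subseteq V(G)$, $N(S)$ is the set of vertices adjacent to some vertex of $S$. Let $d(G)=\max\{|S|-|N(S)|: S\subseteq V(G)\}$. A critical independent set is an independent set $S$ (possibly empty) with $|S|-|N(S)|=d(G)$. Then $\ker(G)$ is the intersection of all critical independent sets of $G$. -}

module Defs where

open import Data.Nat using (ℕ; zero; suc; _≤_)
open import Data.Fin using (Fin)
open import Data.Bool using (Bool; true; false; _∧_)
open import Data.Vec using (Vec; []; _∷_; tabulate; lookup)
open import Data.List using (List; []; _∷_; _++_; map; foldr; allFin; length; concat; last)
open import Data.List.Relation.Unary.All using (All)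
open import Data.List.Relation.Binary.Permutation.Propositional using (_↭_)
open import Data.Maybe using (Maybe; just; nothing)
open import Data.Bool.ListAction using (any)
open import Data.Integer using (ℤ; +_; _-_; _⊔_; 0ℤ)
open import Data.Fin.Subset using (Subset; Side; inside; outside; _∈_; _∉_; ∣_∣)
open import Data.Product using (Σ; _×_)
open import Relation.Binary.PropositionalEquality using (_≡_)
open import Relation.Nullary using (¬_)

record Graph (n : ℕ) : Set where
  field
    adj    : Fin n → Fin n → Bool
    sym    : ∀ u v → adj u v ≡ adj v u
    irrefl : ∀ v → adj v v ≡ false

open Graph public

Adj : ∀ {n} → Graph n → Fin n → Fin n → Set
Adj G u v = adj G u v ≡ true

data Walk {n} (G : Graph n) : List (Fin n) → Set where
  []  : Walk G []
  [_] : ∀ v → Walk G (v ∷ [])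
  _∷_ : ∀ {u v vs} → Adj G u v → Walk G (v ∷ vs) → Walk G (u ∷ v ∷ vs)

-- A list of vertices v₀ v₁ … v_{k-1} (k ≥ 3) traversing a cycle of G:
-- consecutive vertices adjacent and v_{k-1} adjacent to v₀.
-- (Distinctness of the vertices is enforced globally in HasSachsSubgraph.)
record CycleOf {n} (G : Graph n) (vs : List (Fin n)) : Set where
  field
    len≥3   : 3 ≤ length vs
    walk    : Walk G vs
    closing : ∀ {u w} → Data.List.head vs ≡ just u → last vs ≡ just w → Adj G w u

data Component {n} (G : Graph n) : List (Fin n) → Set where
  edge  : ∀ {u v} → Adj G u v → Component G (u ∷ v ∷ [])
  cycle : ∀ {vs} → CycleOf G vs → Component G vs

-- G has a Sachs subgraph: a spanning subgraph whose connected components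
-- are each K₂ or a cycle. It is given by the list of its components; the
-- components are vertex-disjoint and cover V(G), i.e. the concatenation of
-- their vertex lists is a permutation of the list of all vertices.
HasSachsSubgraph : ∀ {n} → Graph n → Set
HasSachsSubgraph {n} G =
  Σ (List (List (Fin n))) λ cs → All (Component G) cs × (concat cs ↭ allFin n)

isInside : Side → Bool
isInside inside  = true
isInside outside = false

N : ∀ {n} → Graph n → Subset n → Subset n
N {n} G S = tabulate λ v →
  toSide (any (λ u → isInside (lookup S u) ∧ adj G u v) (allFin n))
  where
  toSide : Bool → Side
  toSide true  = inside
  toSide false = outside

surplus : ∀ {n} → Graph n → Subset n → ℤ
surplus G S = + ∣ S ∣ - + ∣ N G S ∣

allSubsets : ∀ n → List (Subset n)
allSubsets zero    = [] ∷ []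
allSubsets (suc n) = map (inside ∷_) (allSubsets n) ++ map (outside ∷_) (allSubsets n)

-- d(G) = max { |S| - |N(S)| : S ⊆ V(G) }  (the empty set contributes 0,
-- so starting the fold at 0 does not change the maximum).
d : ∀ {n} → Graph n → ℤ
d {n} G = foldr (λ S m → surplus G S ⊔ m) 0ℤ (allSubsets n)

Independent : ∀ {n} → Graph n → Subset n → Set
Independent G S = ∀ u v → u ∈ S → v ∈ S → ¬ Adj G u v

CriticalIndependent : ∀ {n} → Graph n → Subset n → Set
CriticalIndependent G S = Independent G S × (surplus G S ≡ d G)

_∈ker_ : ∀ {n} → Fin n → Graph n → Set
v ∈ker G = ∀ S → CriticalIndependent G S → v ∈ S

KerEmpty : ∀ {n} → Graph n → Set
KerEmpty {n} G = ∀ (v : Fin n) → ¬ (v ∈ker G)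

module Submission where

-- A Sachs subgraph is the same thing as a permutation σ of V(G) with v ~ σ v for every v: rotate each
-- cycle (and swap the ends of each K₂); conversely the orbits of σ are edges (period 2) or cycles
-- (period ≥ 3; period 1 is ruled out because G has no loops). Counting along σ gives Hall's condition
-- |S| ≤ |N(S)| for every S, and Hall's marriage theorem, applied to the bipartite double cover of G,
-- gives σ back from it. Hall's condition says precisely d(G) = 0, and then ∅ is a critical independent
-- set, so ker(G) = ∅. Conversely S ↦ |S| - |N(S)| is supermodular, so sets of maximal surplus are closed
-- under intersection; if ker(G) = ∅, intersecting, for each vertex v, a critical independent set missing v
-- yields an empty set of maximal surplus, whence d(G) = 0.

open import Defs hiding (sym)
open import Data.Bool using (true; false; T; _∧_)
open import Data.Bool.ListAction using (any)
open import Data.Bool.Properties using (T-≡; T-∧) renaming (_≟_ to _≟ᵇ_)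
open import Data.Fin as Fin using (Fin; toℕ; fromℕ<)
import Data.Fin.Properties as Fin
open import Data.Fin.Subset
  using (Subset; inside; outside; _∈_; _∉_; _⊆_; _⊂_; _∪_; _∩_; _─_; _-_; ∣_∣; ⊥; ⊤; ⁅_⁆; Nonempty; Empty)
open import Data.Fin.Subset.Induction using (⊂-wellFounded)
open import Data.Fin.Subset.Properties
  using (_∈?_; _⊂?_; nonempty?; anySubset?; x∈p∪q⁺; x∈p∪q⁻; x∈p∩q⁺; x∈p∩q⁻; p∩q⊆q; p─q⊆p; x∈p∧x∉q⇒x∈p─q;
         x∈p∧x≢y⇒x∈p-y; x∈⁅x⁆; x∈⁅y⁆⇒x≡y; ∣⁅x⁆∣≡1; ∉⊥; ∈⊤; ∣⊥∣≡0; Empty-unique; ∩-identityʳ;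
         p⊆q⇒∣p∣≤∣q∣; p∩q≢∅⇒p─q⊂p; x∈p⇒p-x⊂p)
open import Data.Integer as ℤ using (ℤ; 0ℤ; _⊔_; +≤+)
import Data.Integer.Properties as ℤ
open import Data.Integer.Tactic.RingSolver using (solve-∀)
open import Data.List using (List; []; _∷_; _∷ʳ_; foldr; map; concat; filter; length; tabulate; allFin; last)
import Data.List.Membership.Propositional as List
open import Data.List.Membership.Propositional.Properties
  using (∈-++⁺ˡ; ∈-++⁺ʳ; ∈-++⁻; ∈-map⁺; ∈-tabulate⁺; ∈-tabulate⁻; ∈-allFin)
open import Data.List.Membership.Propositional.Properties.WithK using (unique∧set⇒bag)
open import Data.List.Relation.Binary.BagAndSetEquality using (∼bag⇒↭)
open import Data.List.Relation.Binary.Permutation.Propositional using (_↭_; ↭-refl; ↭-sym; ↭-trans)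
open import Data.List.Relation.Binary.Permutation.Propositional.Properties using (↭-length; filter-↭; ∷↭∷ʳ; ++⁺)
open import Data.List.Relation.Binary.Pointwise as Pointwise using (Pointwise; []; _∷_)
open import Data.List.Relation.Unary.All using (All; []; _∷_)
open import Data.List.Relation.Unary.AllPairs using ([])
open import Data.List.Relation.Unary.Any using (here; there; satisfied; any?)
open import Data.List.Relation.Unary.Any.Properties using (any⁺; any⁻)
open import Data.List.Relation.Unary.Unique.Propositional using (Unique)
import Data.List.Relation.Unary.Unique.Propositional.Properties as Unique
open import Data.Maybe using (just)
open import Data.Maybe.Properties using (just-injective)
open import Data.Nat using (ℕ; zero; suc; _+_; _≤_; _<_; _≤?_; z≤n; s≤s; s≤s⁻¹)
open import Data.Nat.GeneralisedArithmetic using (iterate)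
open import Data.Nat.Induction using (<-rec)
open import Data.Nat.Properties
  using (+-suc; +-comm; +-identityʳ; m≤m+n; m≤n+m; m≤n⇒m≤1+n; n<1+n; ≤-trans; ≤-<-trans; <-≤-trans;
         ≤-reflexive; ≰⇒>; n>0⇒n≢0; +-mono-≤; +-monoʳ-≤; +-cancelʳ-≤; anyUpTo?; m≤n⇒∃[o]m+o≡n; module ≤-Reasoning)
open import Data.Product using (∃; _×_; _,_; proj₁; proj₂)
open import Data.Sum as Sum using (_⊎_; inj₁; inj₂; [_,_]′)
import Data.Vec as Vec
open import Data.Vec using ([]; _∷_)
open import Data.Vec.Properties using (lookup∘tabulate; []=⇒lookup; lookup⇒[]=)
open import Function.Base using (id; _∘_)
open import Function.Bundles using (_⇔_; mk⇔; Equivalence)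
open import Function.Definitions using (Injective)
open import Induction.WellFounded using (Acc; acc)
open import Relation.Binary.Definitions using (tri<; tri≈; tri>)
open import Relation.Binary.PropositionalEquality
  using (_≡_; _≢_; refl; sym; trans; cong; cong₂; subst; subst₂; module ≡-Reasoning)
open import Relation.Nullary using (¬_; Dec; yes; no; ¬?; _×-dec_; _→-dec_; contradiction)
open import Relation.Nullary.Decidable using (decidable-stable)
open import Relation.Unary using (Decidable)

∣p∪q∣+∣p∩q∣≡∣p∣+∣q∣ : ∀ {n} (p q : Subset n) → ∣ p ∪ q ∣ + ∣ p ∩ q ∣ ≡ ∣ p ∣ + ∣ q ∣
∣p∪q∣+∣p∩q∣≡∣p∣+∣q∣ []            []            = refl
∣p∪q∣+∣p∩q∣≡∣p∣+∣q∣ (inside ∷ p)  (inside ∷ q)  =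
  cong suc (trans (+-suc _ _) (trans (cong suc (∣p∪q∣+∣p∩q∣≡∣p∣+∣q∣ p q)) (sym (+-suc _ _))))
∣p∪q∣+∣p∩q∣≡∣p∣+∣q∣ (inside ∷ p)  (outside ∷ q) = cong suc (∣p∪q∣+∣p∩q∣≡∣p∣+∣q∣ p q)
∣p∪q∣+∣p∩q∣≡∣p∣+∣q∣ (outside ∷ p) (inside ∷ q)  = trans (cong suc (∣p∪q∣+∣p∩q∣≡∣p∣+∣q∣ p q)) (sym (+-suc _ _))
∣p∪q∣+∣p∩q∣≡∣p∣+∣q∣ (outside ∷ p) (outside ∷ q) = ∣p∪q∣+∣p∩q∣≡∣p∣+∣q∣ p q

∣p∪q∣≤∣p∣+∣q∣ : ∀ {n} (p q : Subset n) → ∣ p ∪ q ∣ ≤ ∣ p ∣ + ∣ q ∣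
∣p∪q∣≤∣p∣+∣q∣ p q = subst (∣ p ∪ q ∣ ≤_) (∣p∪q∣+∣p∩q∣≡∣p∣+∣q∣ p q) (m≤m+n _ _)

Empty⇒∣p∣≡0 : ∀ {n} {p : Subset n} → Empty p → ∣ p ∣ ≡ 0
Empty⇒∣p∣≡0 {n} p-empty = trans (cong ∣_∣ (Empty-unique p-empty)) (∣⊥∣≡0 n)

∣p∪q∣≡∣p∣+∣q∣ : ∀ {n} {p q : Subset n} → Empty (p ∩ q) → ∣ p ∪ q ∣ ≡ ∣ p ∣ + ∣ q ∣
∣p∪q∣≡∣p∣+∣q∣ {p = p} {q} disjoint = begin
  ∣ p ∪ q ∣              ≡⟨ +-identityʳ _ ⟨
  ∣ p ∪ q ∣ + 0          ≡⟨ cong (λ k → ∣ p ∪ q ∣ + k) (Empty⇒∣p∣≡0 disjoint) ⟨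
  ∣ p ∪ q ∣ + ∣ p ∩ q ∣  ≡⟨ ∣p∪q∣+∣p∩q∣≡∣p∣+∣q∣ p q ⟩
  ∣ p ∣ + ∣ q ∣          ∎
  where open ≡-Reasoning

∣p∣>0⇒Nonempty : ∀ {n} {p : Subset n} → 0 < ∣ p ∣ → Nonempty p
∣p∣>0⇒Nonempty {p = p} ∣p∣>0 = decidable-stable (nonempty? p) λ p-empty → n>0⇒n≢0 ∣p∣>0 (Empty⇒∣p∣≡0 p-empty)

x∈p⇒⁅x⁆⊆p : ∀ {n} {p : Subset n} {x} → x ∈ p → ⁅ x ⁆ ⊆ p
x∈p⇒⁅x⁆⊆p {p = p} {x} x∈p y∈⁅x⁆ = subst (_∈ p) (sym (x∈⁅y⁆⇒x≡y x y∈⁅x⁆)) x∈p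

x∈p─q⇒x∉q : ∀ {n} {p q : Subset n} {x} → x ∈ p ─ q → x ∉ q
x∈p─q⇒x∉q {p = _ ∷ _} {inside ∷ _} {Fin.zero}  ()                   Vec.here
x∈p─q⇒x∉q {p = _ ∷ _} {_ ∷ _}      {Fin.suc x} (Vec.there x∈p─q) (Vec.there x∈q) = x∈p─q⇒x∉q x∈p─q x∈q

count : ∀ {n} → Subset n → List (Fin n) → ℕ
count S xs = length (filter (_∈? S) xs)

count-↭ : ∀ {n} (S : Subset n) {xs ys} → xs ↭ ys → count S xs ≡ count S ys
count-↭ S xs↭ys = ↭-length (filter-↭ (_∈? S) xs↭ys)

count-tabulate-suc : ∀ {m n} s (p : Subset n) (g : Fin m → Fin n) →
                     count (s ∷ p) (tabulate (Fin.suc ∘ g)) ≡ count p (tabulate g)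
count-tabulate-suc {zero}  s p g = refl
count-tabulate-suc {suc m} s p g with g Fin.zero ∈? p
... | yes _ = cong suc (count-tabulate-suc s p (g ∘ Fin.suc))
... | no  _ = count-tabulate-suc s p (g ∘ Fin.suc)

count-allFin : ∀ {n} (S : Subset n) → count S (allFin n) ≡ ∣ S ∣
count-allFin []            = refl
count-allFin (inside ∷ p)  = cong suc (trans (count-tabulate-suc inside p id) (count-allFin p))
count-allFin (outside ∷ p) = trans (count-tabulate-suc outside p id) (count-allFin p)

count-mono : ∀ {n} {S T : Subset n} {xs ys} → Pointwise (λ x y → x ∈ S → y ∈ T) xs ys → count S xs ≤ count T ys
count-mono [] = z≤n
count-mono {S = S} {T} {x ∷ _} {y ∷ _} (x∈S⇒y∈T ∷ rest) with x ∈? S | y ∈? T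
... | yes _   | yes _   = s≤s (count-mono rest)
... | yes x∈S | no  y∉T = contradiction (x∈S⇒y∈T x∈S) y∉T
... | no  _   | yes _   = m≤n⇒m≤1+n (count-mono rest)
... | no  _   | no  _   = count-mono rest

rotate : ∀ {A : Set} → List A → List A
rotate []       = []
rotate (x ∷ xs) = xs ∷ʳ x

rotate-↭ : ∀ {A : Set} (xs : List A) → rotate xs ↭ xs
rotate-↭ []       = ↭-refl
rotate-↭ (x ∷ xs) = ↭-sym (∷↭∷ʳ x xs)

last-∷ : ∀ {A : Set} (x : A) xs → ∃ λ y → last (x ∷ xs) ≡ just y
last-∷ x []       = x , refl
last-∷ _ (y ∷ ys) = last-∷ y ys

≤-foldr-⊔ : ∀ {A : Set} (g : A → ℤ) z {x xs} → x List.∈ xs → g x ℤ.≤ foldr (λ y m → g y ⊔ m) z xs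
≤-foldr-⊔ g z {xs = y ∷ _} (here refl)  = ℤ.i≤i⊔j (g y) _
≤-foldr-⊔ g z {xs = y ∷ _} (there x∈ys) = ℤ.≤-trans (≤-foldr-⊔ g z x∈ys) (ℤ.i≤j⊔i (g y) _)

foldr-⊔-sel : ∀ {A : Set} (g : A → ℤ) z xs →
              let m = foldr (λ y m → g y ⊔ m) z xs in m ≡ z ⊎ ∃ λ x → m ≡ g x
foldr-⊔-sel g z []       = inj₁ refl
foldr-⊔-sel g z (y ∷ ys) with ℤ.⊔-sel (g y) (foldr (λ y m → g y ⊔ m) z ys)
... | inj₁ eq = inj₂ (y , eq)
... | inj₂ eq with foldr-⊔-sel g z ys
...   | inj₁ eq′       = inj₁ (trans eq eq′)
...   | inj₂ (x , eq′) = inj₂ (x , trans eq eq′)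

module _ where

  -- ℤ's +_ is opened only here: at top level it would make ℕ sums such as ∣ p ∣ + ∣ q ∣ ambiguous.
  open import Data.Integer using (+_)

  difference-sum-≤ : ∀ a b u i x y p q → u + i ≡ a + b → p + q ≤ x + y →
                     (+ a ℤ.- + x) ℤ.+ (+ b ℤ.- + y) ℤ.≤ (+ u ℤ.- + p) ℤ.+ (+ i ℤ.- + q)
  difference-sum-≤ a b u i x y p q u+i≡a+b p+q≤x+y = begin
    (+ a ℤ.- + x) ℤ.+ (+ b ℤ.- + y)   ≡⟨ regroup (+ a) (+ b) (+ x) (+ y) ⟩
    (+ a ℤ.+ + b) ℤ.- (+ x ℤ.+ + y)   ≡⟨ cong₂ ℤ._-_ (ℤ.pos-+ a b) (ℤ.pos-+ x y) ⟨
    + (a + b) ℤ.- + (x + y)           ≡⟨ cong (λ s → + s ℤ.- + (x + y)) u+i≡a+b ⟨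
    + (u + i) ℤ.- + (x + y)           ≤⟨ ℤ.+-monoʳ-≤ (+ (u + i)) (ℤ.neg-mono-≤ (+≤+ p+q≤x+y)) ⟩
    + (u + i) ℤ.- + (p + q)           ≡⟨ cong₂ ℤ._-_ (ℤ.pos-+ u i) (ℤ.pos-+ p q) ⟩
    (+ u ℤ.+ + i) ℤ.- (+ p ℤ.+ + q)   ≡⟨ regroup (+ u) (+ i) (+ p) (+ q) ⟨
    (+ u ℤ.- + p) ℤ.+ (+ i ℤ.- + q)   ∎
    where
    open ℤ.≤-Reasoning
    regroup : ∀ a b x y → (a ℤ.- x) ℤ.+ (b ℤ.- y) ≡ (a ℤ.+ b) ℤ.- (x ℤ.+ y)
    regroup = solve-∀

least-witness : ∀ {P : ℕ → Set} → Decidable P → ∃ P → ∃ λ m → P m × (∀ {j} → j < m → ¬ P j)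
least-witness {P} P? (k , Pk) = <-rec (λ k → P k → Least) step k Pk
  where
  Least = ∃ λ m → P m × (∀ {j} → j < m → ¬ P j)
  step : ∀ k → (∀ {j} → j < k → P j → Least) → P k → Least
  step k below Pk with anyUpTo? P? k
  ... | yes (j , j<k , Pj) = below j<k Pj
  ... | no  none           = k , Pk , λ j<k Pj → none (_ , j<k , Pj)

module _ {A : Set} (f : A → A) where

  iterate-+ : ∀ x i j → iterate f x (i + j) ≡ iterate f (iterate f x i) j
  iterate-+ x zero    j = refl
  iterate-+ x (suc i) j = iterate-+ (f x) i j

  iterate-suc : ∀ x k → iterate f x (suc k) ≡ f (iterate f x k)
  iterate-suc x zero    = refl
  iterate-suc x (suc k) = iterate-suc (f x) k

  iterate-injective : Injective _≡_ _≡_ f → ∀ k {x y} → iterate f x k ≡ iterate f y k → x ≡ y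
  iterate-injective f-inj zero    eq = eq
  iterate-injective f-inj (suc k) eq = f-inj (iterate-injective f-inj k eq)

  iterate-return : Injective _≡_ _≡_ f → ∀ {x} i k →
                   iterate f x i ≡ iterate f x (suc i + k) → iterate f x (suc k) ≡ x
  iterate-return f-inj {x} i k eq = sym (iterate-injective f-inj i (begin
    iterate f x i                      ≡⟨ eq ⟩
    iterate f x (suc i + k)            ≡⟨ cong (iterate f x ∘ suc) (+-comm i k) ⟩
    iterate f x (suc k + i)            ≡⟨ iterate-+ x (suc k) i ⟩
    iterate f (iterate f x (suc k)) i  ∎))
    where open ≡-Reasoning

  iterate-closed : ∀ {P : A → Set} → (∀ {x} → P (f x) → P x) → ∀ k {x} → P (iterate f x k) → P x
  iterate-closed {P} closed zero    Px = Px
  iterate-closed {P} closed (suc k) {x} P[fᵏ⁺¹x] = closed (iterate-closed {P} closed k {f x} P[fᵏ⁺¹x])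

module Neighbourhood {n : ℕ} (G : Graph n) where

  private
    -- N is defined through a local Bool → Side conversion; abstracting over the call to any makes it compute.
    lookup-N : ∀ S v → Vec.lookup (N G S) v ≡ any (λ u → isInside (Vec.lookup S u) ∧ adj G u v) (allFin n)
    lookup-N S v with trans (sym (lookup∘tabulate _ v)) (refl {x = Vec.lookup (N G S) v})
    ... | eq with any (λ u → isInside (Vec.lookup S u) ∧ adj G u v) (allFin n)
    ...   | true  = sym eq
    ...   | false = sym eq

    T-isInside : ∀ {s} → T (isInside s) → s ≡ inside
    T-isInside {true} _ = refl

  ∈-N⁻ : ∀ {S v} → v ∈ N G S → ∃ λ u → u ∈ S × Adj G u v
  ∈-N⁻ {S} {v} v∈NS
    with satisfied (any⁻ _ (allFin n) (Equivalence.from T-≡ (trans (sym (lookup-N S v)) ([]=⇒lookup v∈NS))))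
  ... | u , hit with Equivalence.to T-∧ hit
  ...   | u∈S , uv = u , lookup⇒[]= u S (T-isInside u∈S) , Equivalence.to T-≡ uv

  ∈-N⁺ : ∀ {S u v} → Adj G u v → u ∈ S → v ∈ N G S
  ∈-N⁺ {S} {u} {v} uv u∈S =
    lookup⇒[]= v (N G S) (trans (lookup-N S v) (Equivalence.to T-≡ (any⁺ _ (List.lose (∈-allFin u) hit))))
    where
    hit : T (isInside (Vec.lookup S u) ∧ adj G u v)
    hit rewrite []=⇒lookup u∈S | uv = _

  N-∪ : ∀ A B → N G (A ∪ B) ⊆ N G A ∪ N G B
  N-∪ A B x∈N with ∈-N⁻ x∈N
  ... | u , u∈A∪B , ux = x∈p∪q⁺ (Sum.map (∈-N⁺ ux) (∈-N⁺ ux) (x∈p∪q⁻ A B u∈A∪B))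

  N-∩ : ∀ A B → N G (A ∩ B) ⊆ N G A ∩ N G B
  N-∩ A B x∈N with ∈-N⁻ x∈N
  ... | u , u∈A∩B , ux with x∈p∩q⁻ A B u∈A∩B
  ...   | u∈A , u∈B = x∈p∩q⁺ (∈-N⁺ ux u∈A , ∈-N⁺ ux u∈B)

HallCondition : ∀ {n} → Graph n → Set
HallCondition G = ∀ S → ∣ S ∣ ≤ ∣ N G S ∣

module _ {n : ℕ} (G : Graph n) where

  open Neighbourhood G

  walk-∷ʳ : ∀ {y ys w x} → Walk G (y ∷ ys) → last (y ∷ ys) ≡ just w → Adj G w x →
            Pointwise (Adj G) (y ∷ ys) (ys ∷ʳ x)
  walk-∷ʳ [ _ ]          refl   wx = wx ∷ []
  walk-∷ʳ (yv ∷ walk) last≡w wx = yv ∷ walk-∷ʳ walk last≡w wx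

  component-rotate : ∀ {c} → Component G c → Pointwise (Adj G) c (rotate c)
  component-rotate (edge {u} {v} uv) = uv ∷ trans (Graph.sym G v u) uv ∷ []
  component-rotate (cycle {[]} C) with CycleOf.len≥3 C
  ... | ()
  component-rotate (cycle {y ∷ ys} C) with last-∷ y ys
  ... | w , last≡w = walk-∷ʳ (CycleOf.walk C) last≡w (CycleOf.closing C refl last≡w)

  components-rotate : ∀ {cs} → All (Component G) cs → Pointwise (Adj G) (concat cs) (concat (map rotate cs))
  components-rotate []           = []
  components-rotate (c ∷ comps) = Pointwise.++⁺ (component-rotate c) (components-rotate comps)

  concat-rotate-↭ : ∀ (cs : List (List (Fin n))) → concat (map rotate cs) ↭ concat cs
  concat-rotate-↭ []       = ↭-refl
  concat-rotate-↭ (c ∷ cs) = ++⁺ (rotate-↭ c) (concat-rotate-↭ cs)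

  sachs⇒hall : HasSachsSubgraph G → HallCondition G
  sachs⇒hall (cs , comps , cs↭V) S = begin
    ∣ S ∣                                   ≡⟨ count-allFin S ⟨
    count S (allFin n)                      ≡⟨ count-↭ S cs↭V ⟨
    count S (concat cs)                     ≤⟨ count-mono (Pointwise.map ∈-N⁺ (components-rotate comps)) ⟩
    count (N G S) (concat (map rotate cs))  ≡⟨ count-↭ (N G S) (↭-trans (concat-rotate-↭ cs) cs↭V) ⟩
    count (N G S) (allFin n)                ≡⟨ count-allFin (N G S) ⟩
    ∣ N G S ∣                               ∎
    where open ≤-Reasoning

allSubsets-complete : ∀ {n} (S : Subset n) → S List.∈ allSubsets n
allSubsets-complete []            = here refl
allSubsets-complete (inside ∷ S)  = ∈-++⁺ˡ (∈-map⁺ (inside ∷_) (allSubsets-complete S))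
allSubsets-complete {suc n} (outside ∷ S) =
  ∈-++⁺ʳ (map (inside ∷_) (allSubsets n)) (∈-map⁺ (outside ∷_) (allSubsets-complete S))

Critical : ∀ {n} → Graph n → Subset n → Set
Critical G S = surplus G S ≡ d G

module _ {n : ℕ} (G : Graph n) where

  open Neighbourhood G

  surplus≤d : ∀ S → surplus G S ℤ.≤ d G
  surplus≤d S = ≤-foldr-⊔ (surplus G) 0ℤ (allSubsets-complete S)

  surplus-⊥ : surplus G ⊥ ≡ 0ℤ
  surplus-⊥ rewrite Empty⇒∣p∣≡0 (λ (v , v∈N⊥) → ∉⊥ (proj₁ (proj₂ (∈-N⁻ v∈N⊥)))) | ∣⊥∣≡0 n = refl

  d-attained : ∃ λ S → Critical G S
  d-attained with foldr-⊔-sel (surplus G) 0ℤ (allSubsets n)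
  ... | inj₁ d≡0      = ⊥ , trans surplus-⊥ (sym d≡0)
  ... | inj₂ (S , eq) = S , sym eq

  surplus≤0⇒∣S∣≤∣NS∣ : ∀ S → surplus G S ℤ.≤ 0ℤ → ∣ S ∣ ≤ ∣ N G S ∣
  surplus≤0⇒∣S∣≤∣NS∣ S surplus≤0 = ℤ.drop‿+≤+ (ℤ.i-j≤0⇒i≤j surplus≤0)

  ∣S∣≤∣NS∣⇒surplus≤0 : ∀ S → ∣ S ∣ ≤ ∣ N G S ∣ → surplus G S ℤ.≤ 0ℤ
  ∣S∣≤∣NS∣⇒surplus≤0 S ∣S∣≤∣NS∣ = ℤ.i≤j⇒i-j≤0 (+≤+ ∣S∣≤∣NS∣)

  surplus-supermodular : ∀ A B → surplus G A ℤ.+ surplus G B ℤ.≤ surplus G (A ∪ B) ℤ.+ surplus G (A ∩ B)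
  surplus-supermodular A B =
    difference-sum-≤ (∣ A ∣) (∣ B ∣) (∣ A ∪ B ∣) (∣ A ∩ B ∣)
                     (∣ N G A ∣) (∣ N G B ∣) (∣ N G (A ∪ B) ∣) (∣ N G (A ∩ B) ∣)
                     (∣p∪q∣+∣p∩q∣≡∣p∣+∣q∣ A B) N-submodular
    where
    N-submodular : ∣ N G (A ∪ B) ∣ + ∣ N G (A ∩ B) ∣ ≤ ∣ N G A ∣ + ∣ N G B ∣
    N-submodular = ≤-trans (+-mono-≤ (p⊆q⇒∣p∣≤∣q∣ (N-∪ A B)) (p⊆q⇒∣p∣≤∣q∣ (N-∩ A B)))
                           (≤-reflexive (∣p∪q∣+∣p∩q∣≡∣p∣+∣q∣ (N G A) (N G B)))

  critical-∩ : ∀ A B → Critical G A → Critical G B → Critical G (A ∩ B)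
  critical-∩ A B A-critical B-critical = ℤ.≤-antisym (surplus≤d (A ∩ B)) (+-cancelˡ-≤ (d G) (begin
    d G ℤ.+ d G                              ≡⟨ cong₂ ℤ._+_ A-critical B-critical ⟨
    surplus G A ℤ.+ surplus G B              ≤⟨ surplus-supermodular A B ⟩
    surplus G (A ∪ B) ℤ.+ surplus G (A ∩ B)  ≤⟨ ℤ.+-monoˡ-≤ _ (surplus≤d (A ∪ B)) ⟩
    d G ℤ.+ surplus G (A ∩ B)                ∎))
    where
    open ℤ.≤-Reasoning
    +-cancelˡ-≤ : ∀ i {j k} → i ℤ.+ j ℤ.≤ i ℤ.+ k → j ℤ.≤ k
    +-cancelˡ-≤ i {j} {k} i+j≤i+k = begin
      j                    ≡⟨ cancel i j ⟨
      ℤ.- i ℤ.+ (i ℤ.+ j)  ≤⟨ ℤ.+-monoʳ-≤ (ℤ.- i) i+j≤i+k ⟩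
      ℤ.- i ℤ.+ (i ℤ.+ k)  ≡⟨ cancel i k ⟩
      k                    ∎
      where
      cancel : ∀ i j → ℤ.- i ℤ.+ (i ℤ.+ j) ≡ j
      cancel = solve-∀

  hall⇒d≡0 : HallCondition G → d G ≡ 0ℤ
  hall⇒d≡0 hall with d-attained
  ... | S , S-critical = ℤ.≤-antisym (subst (ℤ._≤ 0ℤ) S-critical (∣S∣≤∣NS∣⇒surplus≤0 S (hall S)))
                                     (subst (ℤ._≤ d G) surplus-⊥ (surplus≤d ⊥))

  hall⇒kerEmpty : HallCondition G → KerEmpty G
  hall⇒kerEmpty hall v v∈ker = ∉⊥ (v∈ker ⊥ ((λ u w u∈⊥ _ _ → ∉⊥ u∈⊥) , trans surplus-⊥ (sym (hall⇒d≡0 hall))))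

  independent? : ∀ S → Dec (Independent G S)
  independent? S = Fin.all? λ u → Fin.all? λ v → u ∈? S →-dec (v ∈? S →-dec ¬? (adj G u v ≟ᵇ true))

  kerEmpty⇒critical-avoiding : KerEmpty G → ∀ v → ∃ λ S → Critical G S × v ∉ S
  kerEmpty⇒critical-avoiding ker-empty v
    with anySubset? (λ S → (independent? S ×-dec (surplus G S ℤ.≟ d G)) ×-dec ¬? (v ∈? S))
  ... | yes (S , (_ , S-critical) , v∉S) = S , S-critical , v∉S
  ... | no  none = contradiction (λ S S-ci → decidable-stable (v ∈? S) λ v∉S → none (S , S-ci , v∉S)) (ker-empty v)

  critical-avoiding-all : (∀ v → ∃ λ S → Critical G S × v ∉ S) →
                          ∀ vs → ∃ λ S → Critical G S × (∀ {v} → v List.∈ vs → v ∉ S)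
  critical-avoiding-all avoid [] with d-attained
  ... | S , S-critical = S , S-critical , λ ()
  critical-avoiding-all avoid (v ∷ vs) with avoid v | critical-avoiding-all avoid vs
  ... | S , S-critical , v∉S | T , T-critical , vs∉T = S ∩ T , critical-∩ S T S-critical T-critical , λ where
    (here refl)  w∈S∩T → v∉S (proj₁ (x∈p∩q⁻ S T w∈S∩T))
    (there w∈vs) w∈S∩T → vs∉T w∈vs (proj₂ (x∈p∩q⁻ S T w∈S∩T))

  kerEmpty⇒hall : KerEmpty G → HallCondition G
  kerEmpty⇒hall ker-empty S with critical-avoiding-all (kerEmpty⇒critical-avoiding ker-empty) (allFin n)
  ... | T , T-critical , T-avoids = surplus≤0⇒∣S∣≤∣NS∣ S (ℤ.≤-trans (surplus≤d S) d≤0)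
    where
    ∣T∣≡0 : ∣ T ∣ ≡ 0
    ∣T∣≡0 = Empty⇒∣p∣≡0 λ (v , v∈T) → T-avoids (∈-allFin v) v∈T
    d≤0 : d G ℤ.≤ 0ℤ
    d≤0 = subst (ℤ._≤ 0ℤ) T-critical (∣S∣≤∣NS∣⇒surplus≤0 T (subst (_≤ ∣ N G T ∣) (sym ∣T∣≡0) z≤n))

-- Hall's theorem for the bipartite double cover of G: A and B live in the two copies of V(G).
module Marriage {n : ℕ} (G : Graph n) where

  open Neighbourhood G

  HallConditionOn : Subset n → Subset n → Set
  HallConditionOn A B = ∀ {S} → S ⊆ A → ∣ S ∣ ≤ ∣ N G S ∩ B ∣

  record Matching (A B : Subset n) : Set where
    field
      mate     : Fin n → Fin n
      mate-∈   : ∀ {a} → a ∈ A → mate a ∈ B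
      mate-adj : ∀ {a} → a ∈ A → Adj G a (mate a)
      mate-inj : ∀ {a a′} → a ∈ A → a′ ∈ A → mate a ≡ mate a′ → a ≡ a′

  empty-matching : ∀ {A B} → Empty A → Matching A B
  empty-matching A-empty = record
    { mate     = λ a → a
    ; mate-∈   = λ a∈A → contradiction (_ , a∈A) A-empty
    ; mate-adj = λ a∈A → contradiction (_ , a∈A) A-empty
    ; mate-inj = λ a∈A _ _ → contradiction (_ , a∈A) A-empty
    }

  singleton-matching : ∀ {a b} → Adj G a b → Matching ⁅ a ⁆ ⁅ b ⁆
  singleton-matching {a} {b} ab = record
    { mate     = λ _ → b
    ; mate-∈   = λ _ → x∈⁅x⁆ b
    ; mate-adj = λ a′∈⁅a⁆ → subst (λ x → Adj G x b) (sym (x∈⁅y⁆⇒x≡y a a′∈⁅a⁆)) ab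
    ; mate-inj = λ a₁∈⁅a⁆ a₂∈⁅a⁆ _ → trans (x∈⁅y⁆⇒x≡y a a₁∈⁅a⁆) (sym (x∈⁅y⁆⇒x≡y a a₂∈⁅a⁆))
    }

  matching-into-N : ∀ {A B} → Matching A B → Matching A (N G A ∩ B)
  matching-into-N M = record
    { mate     = mate
    ; mate-∈   = λ a∈A → x∈p∩q⁺ (∈-N⁺ (mate-adj a∈A) a∈A , mate-∈ a∈A)
    ; mate-adj = mate-adj
    ; mate-inj = mate-inj
    }
    where open Matching M

  matching-split : ∀ {A B S X} → X ⊆ B → Matching S X → Matching (A ─ S) (B ─ X) → Matching A B
  matching-split {A} {B} {S} {X} X⊆B M₁ M₂ =
    record { mate = mate ; mate-∈ = mate-∈ ; mate-adj = mate-adj ; mate-inj = mate-inj }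
    where
    module M₁ = Matching M₁
    module M₂ = Matching M₂

    mate : Fin n → Fin n
    mate a with a ∈? S
    ... | yes _ = M₁.mate a
    ... | no  _ = M₂.mate a

    mate-∈ : ∀ {a} → a ∈ A → mate a ∈ B
    mate-∈ {a} a∈A with a ∈? S
    ... | yes a∈S = X⊆B (M₁.mate-∈ a∈S)
    ... | no  a∉S = p─q⊆p B X (M₂.mate-∈ (x∈p∧x∉q⇒x∈p─q a∈A a∉S))

    mate-adj : ∀ {a} → a ∈ A → Adj G a (mate a)
    mate-adj {a} a∈A with a ∈? S
    ... | yes a∈S = M₁.mate-adj a∈S
    ... | no  a∉S = M₂.mate-adj (x∈p∧x∉q⇒x∈p─q a∈A a∉S)

    mates-apart : ∀ {a a′} → a ∈ S → a′ ∈ A → a′ ∉ S → M₁.mate a ≢ M₂.mate a′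
    mates-apart a∈S a′∈A a′∉S eq =
      x∈p─q⇒x∉q (M₂.mate-∈ (x∈p∧x∉q⇒x∈p─q a′∈A a′∉S)) (subst (_∈ X) eq (M₁.mate-∈ a∈S))

    mate-inj : ∀ {a a′} → a ∈ A → a′ ∈ A → mate a ≡ mate a′ → a ≡ a′
    mate-inj {a} {a′} a∈A a′∈A eq with a ∈? S | a′ ∈? S
    ... | yes a∈S | yes a′∈S = M₁.mate-inj a∈S a′∈S eq
    ... | yes a∈S | no  a′∉S = contradiction eq (mates-apart a∈S a′∈A a′∉S)
    ... | no  a∉S | yes a′∈S = contradiction (sym eq) (mates-apart a′∈S a∈A a∉S)
    ... | no  a∉S | no  a′∉S = M₂.mate-inj (x∈p∧x∉q⇒x∈p─q a∈A a∉S) (x∈p∧x∉q⇒x∈p─q a′∈A a′∉S) eq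

  hall-⊆ : ∀ {A A′ B} → A′ ⊆ A → HallConditionOn A B → HallConditionOn A′ B
  hall-⊆ A′⊆A hall S⊆A′ = hall (A′⊆A ∘ S⊆A′)

  hall-after-tight : ∀ {A B S} → HallConditionOn A B → S ⊆ A → ∣ N G S ∩ B ∣ ≤ ∣ S ∣ →
                     HallConditionOn (A ─ S) (B ─ (N G S ∩ B))
  hall-after-tight {A} {B} {S} hall S⊆A tight {T} T⊆A─S = +-cancelʳ-≤ ∣ S ∣ _ _ (begin
    ∣ T ∣ + ∣ S ∣                   ≡⟨ ∣p∪q∣≡∣p∣+∣q∣ T∩S-empty ⟨
    ∣ T ∪ S ∣                       ≤⟨ hall T∪S⊆A ⟩
    ∣ N G (T ∪ S) ∩ B ∣             ≤⟨ p⊆q⇒∣p∣≤∣q∣ split ⟩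
    ∣ (N G T ∩ B′) ∪ (N G S ∩ B) ∣  ≤⟨ ∣p∪q∣≤∣p∣+∣q∣ (N G T ∩ B′) (N G S ∩ B) ⟩
    ∣ N G T ∩ B′ ∣ + ∣ N G S ∩ B ∣  ≤⟨ +-monoʳ-≤ (∣ N G T ∩ B′ ∣) tight ⟩
    ∣ N G T ∩ B′ ∣ + ∣ S ∣          ∎)
    where
    open ≤-Reasoning
    B′ = B ─ (N G S ∩ B)
    T∩S-empty : Empty (T ∩ S)
    T∩S-empty (x , x∈T∩S) = x∈p─q⇒x∉q (T⊆A─S (proj₁ (x∈p∩q⁻ T S x∈T∩S))) (proj₂ (x∈p∩q⁻ T S x∈T∩S))
    T∪S⊆A : T ∪ S ⊆ A
    T∪S⊆A x∈T∪S with x∈p∪q⁻ T S x∈T∪S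
    ... | inj₁ x∈T = p─q⊆p A S (T⊆A─S x∈T)
    ... | inj₂ x∈S = S⊆A x∈S
    split : N G (T ∪ S) ∩ B ⊆ (N G T ∩ B′) ∪ (N G S ∩ B)
    split {x} x∈ with x ∈? N G S ∩ B
    ... | yes x∈NS∩B = x∈p∪q⁺ (inj₂ x∈NS∩B)
    ... | no  x∉NS∩B with x∈p∩q⁻ (N G (T ∪ S)) B x∈
    ...   | x∈N , x∈B with x∈p∪q⁻ (N G T) (N G S) (N-∪ T S x∈N)
    ...     | inj₁ x∈NT = x∈p∪q⁺ (inj₁ (x∈p∩q⁺ (x∈NT , x∈p∧x∉q⇒x∈p─q x∈B x∉NS∩B)))
    ...     | inj₂ x∈NS = contradiction (x∈p∩q⁺ (x∈NS , x∈B)) x∉NS∩B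

  hall-after-loose : ∀ {A B a b} → a ∈ A → (∀ {T} → Nonempty T → T ⊂ A → ∣ T ∣ < ∣ N G T ∩ B ∣) →
                     HallConditionOn (A - a) (B - b)
  hall-after-loose {A} {B} {a} {b} a∈A expands {T} T⊆A-a with nonempty? T
  ... | no T-empty = subst (_≤ ∣ N G T ∩ (B - b) ∣) (sym (Empty⇒∣p∣≡0 T-empty)) z≤n
  ... | yes T-nonempty = s≤s⁻¹ (<-≤-trans (expands T-nonempty T⊂A) (begin
    ∣ N G T ∩ B ∣                       ≤⟨ p⊆q⇒∣p∣≤∣q∣ split ⟩
    ∣ (N G T ∩ (B - b)) ∪ ⁅ b ⁆ ∣       ≤⟨ ∣p∪q∣≤∣p∣+∣q∣ (N G T ∩ (B - b)) ⁅ b ⁆ ⟩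
    ∣ N G T ∩ (B - b) ∣ + ∣ ⁅ b ⁆ ∣     ≡⟨ +-comm (∣ N G T ∩ (B - b) ∣) (∣ ⁅ b ⁆ ∣) ⟩
    ∣ ⁅ b ⁆ ∣ + ∣ N G T ∩ (B - b) ∣     ≡⟨ cong (_+ ∣ N G T ∩ (B - b) ∣) (∣⁅x⁆∣≡1 b) ⟩
    suc ∣ N G T ∩ (B - b) ∣             ∎))
    where
    open ≤-Reasoning
    T⊂A : T ⊂ A
    T⊂A = p─q⊆p A ⁅ a ⁆ ∘ T⊆A-a , a , a∈A , λ a∈T → x∈p─q⇒x∉q (T⊆A-a a∈T) (x∈⁅x⁆ a)
    split : N G T ∩ B ⊆ (N G T ∩ (B - b)) ∪ ⁅ b ⁆
    split {x} x∈ with x∈p∩q⁻ (N G T) B x∈ | x Fin.≟ b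
    ... | _          | yes refl = x∈p∪q⁺ (inj₂ (x∈⁅x⁆ b))
    ... | x∈NT , x∈B | no  x≢b  = x∈p∪q⁺ (inj₁ (x∈p∩q⁺ (x∈NT , x∈p∧x≢y⇒x∈p-y x∈B x≢b)))

  private
    Tight : Subset n → Subset n → Subset n → Set
    Tight A B S = Nonempty S × S ⊂ A × ∣ N G S ∩ B ∣ ≤ ∣ S ∣

    tight? : ∀ A B S → Dec (Tight A B S)
    tight? A B S = nonempty? S ×-dec S ⊂? A ×-dec ∣ N G S ∩ B ∣ ≤? ∣ S ∣

  neighbour-in : ∀ {A B a} → HallConditionOn A B → a ∈ A → ∃ λ b → b ∈ B × Adj G a b
  neighbour-in {A} {B} {a} hall a∈A
    with ∣p∣>0⇒Nonempty (subst (_≤ ∣ N G ⁅ a ⁆ ∩ B ∣) (∣⁅x⁆∣≡1 a) (hall (x∈p⇒⁅x⁆⊆p a∈A)))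
  ... | b , b∈N⁅a⁆∩B with x∈p∩q⁻ (N G ⁅ a ⁆) B b∈N⁅a⁆∩B
  ...   | b∈N⁅a⁆ , b∈B with ∈-N⁻ b∈N⁅a⁆
  ...     | u , u∈⁅a⁆ , ub = b , b∈B , subst (λ x → Adj G x b) (x∈⁅y⁆⇒x≡y a u∈⁅a⁆) ub

  -- Either some nonempty S ⊂ A is tight, and S and A ─ S are matched separately, or every such S has
  -- a spare neighbour, and any a ∈ A can be matched to any neighbour b before recursing on A - a, B - b.
  hall : ∀ {A B} → Acc _⊂_ A → HallConditionOn A B → Matching A B
  hall {A} {B} (acc smaller) hallAB with nonempty? A
  ... | no A-empty = empty-matching A-empty
  ... | yes (a , a∈A) with anySubset? (tight? A B)
  ...   | yes (S , (s , s∈S) , S⊂A@(S⊆A , _) , tight) =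
          matching-split (p∩q⊆q (N G S) B)
            (matching-into-N (hall (smaller S⊂A) (hall-⊆ S⊆A hallAB)))
            (hall (smaller (p∩q≢∅⇒p─q⊂p A S (s , x∈p∩q⁺ (S⊆A s∈S , s∈S)))) (hall-after-tight hallAB S⊆A tight))
  ...   | no no-tight with neighbour-in hallAB a∈A
  ...     | b , b∈B , ab =
          matching-split (x∈p⇒⁅x⁆⊆p b∈B)
            (singleton-matching ab)
            (hall (smaller (x∈p⇒p-x⊂p a∈A)) (hall-after-loose a∈A expands))
    where
    expands : ∀ {T} → Nonempty T → T ⊂ A → ∣ T ∣ < ∣ N G T ∩ B ∣
    expands T≠∅ T⊂A = ≰⇒> λ le → no-tight (_ , T≠∅ , T⊂A , le)

record NeighbourPermutation {n} (G : Graph n) : Set where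
  field
    σ           : Fin n → Fin n
    σ-adj       : ∀ v → Adj G v (σ v)
    σ-injective : Injective _≡_ _≡_ σ

hall⇒neighbourPermutation : ∀ {n} (G : Graph n) → HallCondition G → NeighbourPermutation G
hall⇒neighbourPermutation G hallG = record
  { σ           = mate
  ; σ-adj       = λ _ → mate-adj ∈⊤
  ; σ-injective = mate-inj ∈⊤ ∈⊤
  }
  where
  open Marriage G
  open Matching (hall (⊂-wellFounded ⊤) λ {S} _ → subst (∣ S ∣ ≤_) (cong ∣_∣ (sym (∩-identityʳ (N G S)))) (hallG S))

module CycleDecomposition {n : ℕ} (G : Graph n) (P : NeighbourPermutation G) where

  open NeighbourPermutation P

  returns : ∀ v → ∃ λ k → iterate σ v (suc k) ≡ v
  returns v with Fin.pigeonhole (n<1+n n) (λ (i : Fin (suc n)) → iterate σ v (toℕ i))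
  ... | i , j , i<j , eq with m≤n⇒∃[o]m+o≡n i<j
  ...   | k , i+k≡j = k , iterate-return σ σ-injective (toℕ i) k (trans eq (cong (iterate σ v) (sym i+k≡j)))

  trajectory : Fin n → ℕ → List (Fin n)
  trajectory w k = tabulate {n = k} (λ i → iterate σ w (toℕ i))

  trajectory-walk : ∀ w k → Walk G (trajectory w k)
  trajectory-walk w zero          = []
  trajectory-walk w (suc zero)    = [ w ]
  trajectory-walk w (suc (suc k)) = σ-adj w ∷ trajectory-walk (σ w) (suc k)

  trajectory-last : ∀ w k → last (trajectory w (suc k)) ≡ just (iterate σ w k)
  trajectory-last w zero    = refl
  trajectory-last w (suc k) = trajectory-last (σ w) k

  closed-trajectory-component : ∀ v m → iterate σ v (suc m) ≡ v → Component G (trajectory v (suc m))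
  closed-trajectory-component v zero σv≡v with trans (sym (irrefl G v)) (subst (Adj G v) σv≡v (σ-adj v))
  ... | ()
  closed-trajectory-component v (suc zero) _ = edge (σ-adj v)
  closed-trajectory-component v m@(suc (suc _)) back = cycle record
    { len≥3   = s≤s (s≤s (s≤s z≤n))
    ; walk    = trajectory-walk v (suc m)
    ; closing = λ head≡u last≡w →
        subst₂ (Adj G) (just-injective (trans (sym (trajectory-last v m)) last≡w)) (just-injective head≡u)
               closing-edge
    }
    where
    closing-edge : Adj G (iterate σ v m) v
    closing-edge = subst (Adj G (iterate σ v m)) (trans (sym (iterate-suc σ v m)) back) (σ-adj (iterate σ v m))

  LeastReturn : Fin n → ℕ → Set
  LeastReturn v m = iterate σ v (suc m) ≡ v × (∀ {j} → j < m → iterate σ v (suc j) ≢ v)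

  least-return : ∀ v → ∃ (LeastReturn v)
  least-return v = least-witness (λ k → iterate σ v (suc k) Fin.≟ v) (returns v)

  module Orbit {v m} (least : LeastReturn v m) where

    period : ℕ
    period = suc m

    orbit-at : Fin period → Fin n
    orbit-at i = iterate σ v (toℕ i)

    orbit : List (Fin n)
    orbit = tabulate orbit-at

    orbit-component : Component G orbit
    orbit-component = closed-trajectory-component v m (proj₁ least)

    iterates-distinct : ∀ {i j} → i < j → j < period → iterate σ v i ≢ iterate σ v j
    iterates-distinct {i} i<j j<p eq with m≤n⇒∃[o]m+o≡n i<j
    ... | k , refl = proj₂ least (≤-<-trans (m≤n+m k i) (s≤s⁻¹ j<p)) (iterate-return σ σ-injective i k eq)

    orbit-unique : Unique orbit
    orbit-unique = Unique.tabulate⁺ {f = orbit-at} index-injective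
      where
      index-injective : ∀ {i j} → orbit-at i ≡ orbit-at j → i ≡ j
      index-injective {i} {j} eq with Fin.<-cmp i j
      ... | tri< i<j _ _ = contradiction eq (iterates-distinct i<j (Fin.toℕ<n j))
      ... | tri≈ _ i≡j _ = i≡j
      ... | tri> _ _ j<i = contradiction (sym eq) (iterates-distinct j<i (Fin.toℕ<n i))

    iterate-∈-orbit : ∀ {k} → k < period → iterate σ v k List.∈ orbit
    iterate-∈-orbit k<p =
      subst (λ k → iterate σ v k List.∈ orbit) (Fin.toℕ-fromℕ< k<p) (∈-tabulate⁺ {f = orbit-at} (fromℕ< k<p))

    ∈-orbit⁻ : ∀ {x} → x List.∈ orbit → ∃ λ k → x ≡ iterate σ v k
    ∈-orbit⁻ x∈orbit with ∈-tabulate⁻ {f = orbit-at} x∈orbit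
    ... | i , x≡ = toℕ i , x≡

    orbit-closed : ∀ {x} → σ x List.∈ orbit → x List.∈ orbit
    orbit-closed {x} σx∈orbit = preimage (toℕ i) (Fin.toℕ<n i) σx≡
      where
      i = proj₁ (∈-tabulate⁻ {f = orbit-at} σx∈orbit)
      σx≡ = proj₂ (∈-tabulate⁻ {f = orbit-at} σx∈orbit)
      σ⁻¹-∈-orbit : ∀ {k} → k < period → σ x ≡ iterate σ v (suc k) → x List.∈ orbit
      σ⁻¹-∈-orbit {k} k<p eq =
        subst (List._∈ orbit) (sym (σ-injective (trans eq (iterate-suc σ v k)))) (iterate-∈-orbit k<p)
      preimage : ∀ k → k < period → σ x ≡ iterate σ v k → x List.∈ orbit
      preimage zero    _         eq = σ⁻¹-∈-orbit (n<1+n m) (trans eq (sym (proj₁ least)))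
      preimage (suc k) (s≤s k<m) eq = σ⁻¹-∈-orbit (m≤n⇒m≤1+n k<m) eq

  -- Closure under σ⁻¹ is what keeps the orbit of a vertex outside the cycles disjoint from them.
  record PartialCover (vs : List (Fin n)) : Set where
    field
      cycles     : List (List (Fin n))
      components : All (Component G) cycles
      disjoint   : Unique (concat cycles)
      closed     : ∀ {x} → σ x List.∈ concat cycles → x List.∈ concat cycles
      covers     : ∀ {v} → v List.∈ vs → v List.∈ concat cycles

  add-orbit : ∀ {v vs m} (C : PartialCover vs) → ¬ v List.∈ concat (PartialCover.cycles C) → LeastReturn v m →
              PartialCover (v ∷ vs)
  add-orbit {v} C v∉C least = record
    { cycles     = orbit ∷ cycles
    ; components = orbit-component ∷ components
    ; disjoint   = Unique.++⁺ orbit-unique disjoint orbit-fresh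
    ; closed     = λ σx∈ → [ ∈-++⁺ˡ ∘ orbit-closed , ∈-++⁺ʳ orbit ∘ closed ]′ (∈-++⁻ orbit σx∈)
    ; covers     = λ { (here refl)  → ∈-++⁺ˡ (iterate-∈-orbit {0} (s≤s z≤n))
                     ; (there w∈vs) → ∈-++⁺ʳ orbit (covers w∈vs) }
    }
    where
    open PartialCover C
    open Orbit least
    orbit-fresh : ∀ {x} → ¬ (x List.∈ orbit × x List.∈ concat cycles)
    orbit-fresh (x∈orbit , x∈C) with ∈-orbit⁻ x∈orbit
    ... | k , refl = v∉C (iterate-closed σ {List._∈ concat cycles} closed k x∈C)

  extend : ∀ v {vs} → PartialCover vs → PartialCover (v ∷ vs)
  extend v C with any? (v Fin.≟_) (concat (PartialCover.cycles C))
  ... | yes v∈C = record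
    { cycles = cycles ; components = components ; disjoint = disjoint ; closed = closed
    ; covers = λ { (here refl) → v∈C ; (there w∈vs) → covers w∈vs }
    }
    where open PartialCover C
  ... | no  v∉C = add-orbit C v∉C (proj₂ (least-return v))

  cover : ∀ vs → PartialCover vs
  cover []       = record { cycles = [] ; components = [] ; disjoint = [] ; closed = λ () ; covers = λ () }
  cover (v ∷ vs) = extend v (cover vs)

  sachsSubgraph : HasSachsSubgraph G
  sachsSubgraph = cycles , components ,
    ∼bag⇒↭ (unique∧set⇒bag disjoint (Unique.allFin⁺ n) (mk⇔ (λ _ → ∈-allFin _) (λ _ → covers (∈-allFin _))))
    where open PartialCover (cover (allFin n))

mainTheorem8 : ∀ {n : ℕ} (G : Graph n) → HasSachsSubgraph G ⇔ KerEmpty G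
mainTheorem8 G = mk⇔ (hall⇒kerEmpty G ∘ sachs⇒hall G)
                     (CycleDecomposition.sachsSubgraph G ∘ hall⇒neighbourPermutation G ∘ kerEmpty⇒hall G)
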